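{- Let $t$ be a PPC_dB term, $k\ge0$, $i\geq1$ and $n\ge k+i$, let $X_1,\dots,X_n$ be lists of distinct symbols and $V,M$ lists of lists of distinct symbols, and suppose $fv(t)\cup fm(t)\subseteq\{(i',j)\mid i'\le n-(i-1),\ j\le|X_{i'}|\}$. Then: (1) $\mathcal U_{X_1++\cdots++X_n,\,M}\big((\uparrow^{\mathsf v}_k)^{i-1}t\big)=_\alpha\mathcal U_{X_1++\cdots++X_k++X_{k+i}++\cdots++X_n,\,M}(t)$; (2) $\mathcal U_{V,\,X_1++\cdots++X_n}\big((\uparrow^{\mathsf m}_k)^{i-1}t\big)=_\alpha\mathcal U_{V,\,X_1++\cdots++X_k++X_{k+i}++\cdots++X_n}(t)$.
   Context: **PPC.** PPC terms over a set of symbols: $t::=x\mid\hat x\mid t\,t\mid\lambda_\theta p.s$. $=_\alpha$ denotes $\alpha$-equivalence. **PPC_dB.** PPC_dB terms: $t::=\mathsf v_{i,j}\mid\mathsf m_{i,j}\mid t\,t\mid\lambda_np.s$. Free indices: $fv(\mathsf v_{i,j})=\{(i,j)\}$ and $fm(\mathsf m_{i,j})=\{(i,j)\}$ (empty otherwise); both are unions on applications; $fv(\lambda_np.s)=fv(p)\cup(fv(s)-1)$ and $fm(\lambda_np.s)=(fm(p)-1)\cup fm(s)$. Here $S-1$ decrements first components and drops the non-positive ones. - $\uparrow^{\mathsf v}_k\mathsf v_{i,j}=\mathsf v_{i+1,j}$ if $i>k$, else unchanged; matchables unchanged; homomorphic on applications; $\uparrow^{\mathsf v}_k(\lambda_np.s)=\lambda_n\uparrow^{\mathsf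 v}_kp.\uparrow^{\mathsf v}_{k+1}s$. - $\uparrow^{\mathsf m}_k$ is symmetric on matchable indices, with $\uparrow^{\mathsf m}_k(\lambda_np.s)=\lambda_n\uparrow^{\mathsf m}_{k+1}p.\uparrow^{\mathsf m}_ks$. - $(f)^m$ denotes $m$-fold iteration. **Backward translation.** For lists of lists of symbols ($V_{ij}$ is the $j$-th element of the $i$-th list; $++$ is concatenation; $\theta++V=[\theta]++V$): - $\mathcal U_{V,M}(\mathsf v_{i,j})=V_{ij}$ and $\mathcal U_{V,M}(\mathsf m_{i,j})=\widehat{M_{ij}}$; - homomorphic on applications; - $\mathcal U_{V,M}(\lambda_np.s)=\lambda_\theta\mathcal U_{V,\theta++M}(p).\mathcal U_{\theta++V,M}(s)$, with $\theta$ a list of $n$ fresh symbols. -}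

module Defs where

open import Data.Nat using (ℕ; zero; suc; _+_; _∸_; _≤_; _<_; _<ᵇ_; _⊔_)
open import Data.Bool using (Bool; true; false; if_then_else_)
open import Data.Product using (_×_; _,_; ∃)
open import Data.Sum using (_⊎_)
open import Data.List using (List; []; _∷_; _++_; length; map; foldr; applyUpTo)
open import Data.Maybe using (Maybe; just; nothing; maybe)
open import Relation.Binary.PropositionalEquality using (_≡_)
open import Relation.Nullary using (does)
open import Data.Nat using (_≟_)

Sym : Set
Sym = ℕ

-- PPC terms:  t ::= x | x̂ | t t | λ_θ p.s
-- (θ binds matchables x̂ in p and variables x in s)

data PTerm : Set where
  pvar : Sym → PTerm
  pmat : Sym → PTerm
  papp : PTerm → PTerm → PTerm
  plam : List Sym → PTerm → PTerm → PTerm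

-- Position of a symbol in a binder stack: first layer (1-based) that
-- contains it, and (1-based) index of its first occurrence in that layer.
indexIn : Sym → List Sym → Maybe ℕ
indexIn x [] = nothing
indexIn x (y ∷ ys) = if does (x ≟ y) then just 1 else Data.Maybe.map suc (indexIn x ys)

position : Sym → List (List Sym) → Maybe (ℕ × ℕ)
position x [] = nothing
position x (θ ∷ Γ) with indexIn x θ
... | just j = just (1 , j)
... | nothing = Data.Maybe.map (λ { (i , j) → (suc i , j) }) (position x Γ)

SymRel : List (List Sym) → List (List Sym) → Sym → Sym → Set
SymRel Γ Δ x y =
  (∃ λ p → position x Γ ≡ just p × position y Δ ≡ just p)
  ⊎ (position x Γ ≡ nothing × position y Δ ≡ nothing × x ≡ y)

data AlphaEq (Γv Δv Γm Δm : List (List Sym)) : PTerm → PTerm → Set where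
  avar : ∀ {x y} → SymRel Γv Δv x y → AlphaEq Γv Δv Γm Δm (pvar x) (pvar y)
  amat : ∀ {x y} → SymRel Γm Δm x y → AlphaEq Γv Δv Γm Δm (pmat x) (pmat y)
  aapp : ∀ {t u t' u'} → AlphaEq Γv Δv Γm Δm t t' → AlphaEq Γv Δv Γm Δm u u' →
         AlphaEq Γv Δv Γm Δm (papp t u) (papp t' u')
  alam : ∀ {θ θ' p p' s s'} → length θ ≡ length θ' →
         AlphaEq Γv Δv (θ ∷ Γm) (θ' ∷ Δm) p p' →
         AlphaEq (θ ∷ Γv) (θ' ∷ Δv) Γm Δm s s' →
         AlphaEq Γv Δv Γm Δm (plam θ p s) (plam θ' p' s')

infix 4 _=α_
_=α_ : PTerm → PTerm → Set
t =α u = AlphaEq [] [] [] [] t u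

-- PPC_dB terms:  t ::= v_{i,j} | m_{i,j} | t t | λ_n p.s   (indices 1-based)

data Term : Set where
  v   : ℕ → ℕ → Term
  m   : ℕ → ℕ → Term
  app : Term → Term → Term
  lam : ℕ → Term → Term → Term

dec : List (ℕ × ℕ) → List (ℕ × ℕ)
dec [] = []
dec ((zero , j) ∷ S) = dec S
dec ((suc zero , j) ∷ S) = dec S
dec ((suc (suc i) , j) ∷ S) = (suc i , j) ∷ dec S

fv : Term → List (ℕ × ℕ)
fv (v i j) = (i , j) ∷ []
fv (m i j) = []
fv (app t u) = fv t ++ fv u
fv (lam n p s) = fv p ++ dec (fv s)

fm : Term → List (ℕ × ℕ)
fm (v i j) = []
fm (m i j) = (i , j) ∷ []
fm (app t u) = fm t ++ fm u
fm (lam n p s) = dec (fm p) ++ fm s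

shiftV : ℕ → Term → Term
shiftV k (v i j) = if k <ᵇ i then v (suc i) j else v i j
shiftV k (m i j) = m i j
shiftV k (app t u) = app (shiftV k t) (shiftV k u)
shiftV k (lam n p s) = lam n (shiftV k p) (shiftV (suc k) s)

shiftM : ℕ → Term → Term
shiftM k (v i j) = v i j
shiftM k (m i j) = if k <ᵇ i then m (suc i) j else m i j
shiftM k (app t u) = app (shiftM k t) (shiftM k u)
shiftM k (lam n p s) = lam n (shiftM (suc k) p) (shiftM k s)

iter : {A : Set} → (A → A) → ℕ → A → A
iter f zero x = x
iter f (suc n) x = f (iter f n x)

-- 1-based lookup
nth : {A : Set} → List A → ℕ → Maybe A
nth xs zero = nothing
nth [] (suc i) = nothing
nth (x ∷ xs) (suc zero) = just x
nth (x ∷ xs) (suc (suc i)) = nth xs (suc i)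

-- V_{ij}; out-of-range indices (never relevant in the lemma) default to symbol 0
get : List (List Sym) → ℕ → ℕ → Sym
get V i j with nth V i
... | nothing = 0
... | just l = maybe (λ x → x) 0 (nth l j)

maxSym : List (List Sym) → ℕ
maxSym = foldr (λ l r → foldr _⊔_ r l) 0

-- n fresh, pairwise distinct symbols not occurring in V, M (and ≠ default 0)
fresh : ℕ → List (List Sym) → List (List Sym) → List Sym
fresh n V M = applyUpTo (λ a → suc (maxSym V ⊔ maxSym M + a)) n

U : List (List Sym) → List (List Sym) → Term → PTerm
U V M (v i j) = pvar (get V i j)
U V M (m i j) = pmat (get M i j)
U V M (app t u) = papp (U V M t) (U V M u)
U V M (lam n p s) = plam θ (U V (θ ∷ M) p) (U (θ ∷ V) M s)
  where θ = fresh n V M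

-- length of the i-th (1-based) list, 0 if out of range
lenAt : List (List Sym) → ℕ → ℕ
lenAt X i = maybe length 0 (nth X i)

InRange : List (List Sym) → ℕ → ℕ → ℕ × ℕ → Set
InRange X n i (i' , j) = 1 ≤ i' × i' ≤ n ∸ (i ∸ 1) × 1 ≤ j × j ≤ lenAt X i'

module Submission where

-- The proof is a renaming argument.  A de Bruijn layer index i ≥ 1 is read
-- through a 0-based renaming τ of layers as `liftIx τ i`; `(↑_k)^c` acts on
-- the layer indices of a term exactly as `liftIx (shiftIx k c)`, where
-- `shiftIx k c` moves every layer at depth ≥ k outwards by c.  We call two
-- symbol stacks V, W related along τ (`Agree`) when V's symbol at layer
-- `liftIx τ i` denotes, under the binders met so far, the same thing as
-- W's symbol at layer i.  Going under a binder extends both stacks with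
-- fresh symbols and τ by `liftIx` (`agree-ext`), which is also how
-- `shiftIx (k + 1) c` arises from `shiftIx k c`.  Induction on the term
-- then gives α-equivalence (`U-shiftV`, `U-shiftM`), and at top level the
-- stacks are related because looking up X at `liftIx (shiftIx k c) a`
-- is looking up the cut stack at a (`nth-cut`).  The argument works for
-- every term.

open import Defs
open import Data.List.Relation.Unary.Unique.Propositional using (Unique)
open import Data.Nat using (ℕ; _+_; _∸_; _≤_; zero; suc; _<_; _<ᵇ_; _≡ᵇ_; _⊔_; z≤n; s≤s; pred)
open import Data.Nat.Properties
  using (≤-refl; ≤-trans; ≤-pred; m≤m⊔n; m≤n⊔m; m≤m+n; +-identityʳ; +-suc;
         +-∸-assoc; m+n≤o⇒m≤o; <ᵇ-reflects-<; <⇒<ᵇ; <⇒≱; <⇒≢; ≰⇒>;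
         +-cancelˡ-≡; suc-injective; ≡ᵇ⇒≡; ≡⇒≡ᵇ)
open import Data.Bool using (true; false; if_then_else_; T)
open import Data.Bool.Properties using (T-≡)
open import Data.Product using (_×_; _,_)
open import Data.Sum using (inj₁; inj₂)
open import Data.List using (List; []; _∷_; _++_; length; take; drop; foldr)
open import Data.List.Properties using (length-applyUpTo)
open import Data.List.Relation.Unary.All using (All) renaming (lookup to All-lookup)
open import Data.List.Relation.Unary.AllPairs using (_∷_)
open import Data.List.Relation.Unary.Unique.Propositional.Properties using (applyUpTo⁺₁)
open import Data.List.Membership.Propositional using (_∈_; _∉_)
open import Data.List.Membership.Propositional.Properties using (∈-applyUpTo⁻)
open import Data.List.Relation.Unary.Any using (here; there)
open import Data.Maybe using (just; nothing; maybe) renaming (map to maybe-map)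
open import Data.Empty using (⊥-elim)
open import Function using (id; _∘_; Equivalence)
open import Relation.Nullary using (¬_)
open import Relation.Nullary.Reflects using (ofʸ; ofⁿ)
open import Relation.Binary.PropositionalEquality
  using (_≡_; refl; sym; trans; cong; subst; module ≡-Reasoning)
open ≡-Reasoning

iter-natural : {A B : Set} (f : A → A) (g : B → B) (h : B → A) →
  (∀ x → f (h x) ≡ h (g x)) → ∀ c x → iter f c (h x) ≡ h (iter g c x)
iter-natural f g h comm zero x = refl
iter-natural f g h comm (suc c) x = trans (cong f (iter-natural f g h comm c x)) (comm _)

iter-natural₂ : {A B C : Set} (f : A → A) (g : B → B) (g' : C → C) (h : B → C → A) →
  (∀ x y → f (h x y) ≡ h (g x) (g' y)) →
  ∀ c x y → iter f c (h x y) ≡ h (iter g c x) (iter g' c y)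
iter-natural₂ f g g' h comm zero x y = refl
iter-natural₂ f g g' h comm (suc c) x y =
  trans (cong f (iter-natural₂ f g g' h comm c x y)) (comm _ _)

iter-fixed : {A : Set} (f : A → A) {x : A} → f x ≡ x → ∀ c → iter f c x ≡ x
iter-fixed f fx≡x zero = refl
iter-fixed f fx≡x (suc c) = trans (cong f (iter-fixed f fx≡x c)) fx≡x

-- A 0-based renaming τ of outer layers acting on 1-based layer indices
-- (0 is a junk index and stays fixed).  Going under a binder, the new
-- innermost layer is index 1 and the renaming of the rest is liftIx τ.
liftIx : (ℕ → ℕ) → ℕ → ℕ
liftIx τ zero = zero
liftIx τ (suc a) = suc (τ a)

liftIx-id : ∀ i → liftIx id i ≡ i
liftIx-id zero = refl
liftIx-id (suc i) = refl

-- The layer renaming performed by (↑_k)^c: depths a ≥ k move out by c.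
shiftIx : ℕ → ℕ → ℕ → ℕ
shiftIx k c a = if k <ᵇ suc a then a + c else a

shiftIx-suc : ∀ k c i → shiftIx (suc k) c i ≡ liftIx (shiftIx k c) i
shiftIx-suc k c zero = refl
shiftIx-suc k c (suc a) with k <ᵇ suc a
... | true = refl
... | false = refl

bump : ℕ → ℕ → ℕ
bump k i = if k <ᵇ i then suc i else i

bump-below : ∀ k i → ¬ k < i → bump k i ≡ i
bump-below k i k≮i with k <ᵇ i | <ᵇ-reflects-< k i
... | false | _ = refl
... | true | ofʸ k<i = ⊥-elim (k≮i k<i)

bump-above : ∀ k i → k < i → bump k i ≡ suc i
bump-above k i k<i with k <ᵇ i | <ᵇ-reflects-< k i
... | true | _ = refl
... | false | ofⁿ k≮i = ⊥-elim (k≮i k<i)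

iter-bump : ∀ k c i → iter (bump k) c i ≡ liftIx (shiftIx k c) i
iter-bump k c zero = iter-fixed (bump k) refl c
iter-bump k c (suc a) with k <ᵇ suc a | <ᵇ-reflects-< k (suc a)
... | false | ofⁿ k≮1+a = iter-fixed (bump k) (bump-below k (suc a) k≮1+a) c
... | true | ofʸ k<1+a = above c
  where
  above : ∀ c → iter (bump k) c (suc a) ≡ suc (a + c)
  above zero = cong suc (sym (+-identityʳ a))
  above (suc c) = begin
    bump k (iter (bump k) c (suc a))  ≡⟨ cong (bump k) (above c) ⟩
    bump k (suc (a + c))              ≡⟨ bump-above k _ (≤-trans k<1+a (s≤s (m≤m+n a c))) ⟩
    suc (suc (a + c))                 ≡⟨ cong suc (sym (+-suc a c)) ⟩
    suc (a + suc c)                   ∎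

shiftV-v : ∀ k i j → shiftV k (v i j) ≡ v (bump k i) j
shiftV-v k i j with k <ᵇ i
... | true = refl
... | false = refl

shiftM-m : ∀ k i j → shiftM k (m i j) ≡ m (bump k i) j
shiftM-m k i j with k <ᵇ i
... | true = refl
... | false = refl

iter-shiftV-v : ∀ k c i j → iter (shiftV k) c (v i j) ≡ v (liftIx (shiftIx k c) i) j
iter-shiftV-v k c i j =
  trans (iter-natural (shiftV k) (bump k) (λ i → v i j) (λ i → shiftV-v k i j) c i)
        (cong (λ i → v i j) (iter-bump k c i))

iter-shiftM-m : ∀ k c i j → iter (shiftM k) c (m i j) ≡ m (liftIx (shiftIx k c) i) j
iter-shiftM-m k c i j =
  trans (iter-natural (shiftM k) (bump k) (λ i → m i j) (λ i → shiftM-m k i j) c i)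
        (cong (λ i → m i j) (iter-bump k c i))

nth-drop : {A : Set} (X : List A) → ∀ c a → nth (drop c X) (suc a) ≡ nth X (suc a + c)
nth-drop X zero a = cong (nth X) (cong suc (sym (+-identityʳ a)))
nth-drop [] (suc c) a = refl
nth-drop (x ∷ X) (suc c) a = trans (nth-drop X c a) (cong (nth (x ∷ X)) (cong suc (sym (+-suc a c))))

nth-cut-below : {A : Set} (X Y : List A) → ∀ k a → a ≤ k → k ≤ length X →
  nth (take k X ++ Y) a ≡ nth X a
nth-cut-below X Y k zero a≤k k≤X = refl
nth-cut-below (x ∷ X) Y (suc k) (suc zero) a≤k k≤X = refl
nth-cut-below (x ∷ X) Y (suc k) (suc (suc a)) (s≤s a≤k) (s≤s k≤X) =
  nth-cut-below X Y k (suc a) a≤k k≤X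

nth-cut-above : {A : Set} (X : List A) → ∀ k c a → k < a → k ≤ length X →
  nth (take k X ++ drop (k + c) X) a ≡ nth X (a + c)
nth-cut-above X zero c (suc a) k<a k≤X = nth-drop X c a
nth-cut-above (x ∷ X) (suc k) c (suc (suc a)) (s≤s k<a) (s≤s k≤X) =
  nth-cut-above X k c (suc a) k<a k≤X

nth-cut : {A : Set} (X : List A) → ∀ k c → k ≤ length X →
  ∀ a → nth X (liftIx (shiftIx k c) a) ≡ nth (take k X ++ drop (k + c) X) a
nth-cut X k c k≤X zero = refl
nth-cut X k c k≤X (suc a) with k <ᵇ suc a | <ᵇ-reflects-< k (suc a)
... | true | ofʸ k<1+a = sym (nth-cut-above X k c (suc a) k<1+a k≤X)
... | false | ofⁿ k≮1+a = sym (nth-cut-below X _ k (suc a) (≤-pred (≰⇒> k≮1+a)) k≤X)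

get-cong : ∀ V W i i' j → nth V i ≡ nth W i' → get V i j ≡ get W i' j
get-cong V W i i' j e with nth V i | nth W i' | e
... | nothing | .nothing | refl = refl
... | just l | .(just l) | refl = refl

foldr-⊔-init : ∀ l r → r ≤ foldr _⊔_ r l
foldr-⊔-init [] r = ≤-refl
foldr-⊔-init (x ∷ l) r = ≤-trans (foldr-⊔-init l r) (m≤n⊔m x _)

foldr-⊔-nth : ∀ l r j → maybe id 0 (nth l j) ≤ foldr _⊔_ r l
foldr-⊔-nth l r zero = z≤n
foldr-⊔-nth [] r (suc j) = z≤n
foldr-⊔-nth (x ∷ l) r (suc zero) = m≤m⊔n x _
foldr-⊔-nth (x ∷ l) r (suc (suc j)) = ≤-trans (foldr-⊔-nth l r (suc j)) (m≤n⊔m x _)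

get-≤-maxSym : ∀ V i j → get V i j ≤ maxSym V
get-≤-maxSym V zero j = z≤n
get-≤-maxSym [] (suc i) j = z≤n
get-≤-maxSym (l ∷ V) (suc zero) j = foldr-⊔-nth l (maxSym V) j
get-≤-maxSym (l ∷ V) (suc (suc i)) j =
  ≤-trans (get-≤-maxSym V (suc i) j) (foldr-⊔-init l (maxSym V))

nth-∈ : ∀ {A : Set} (xs : List A) j {x} → nth xs j ≡ just x → x ∈ xs
nth-∈ (y ∷ xs) (suc zero) refl = here refl
nth-∈ (y ∷ xs) (suc (suc j)) e = there (nth-∈ xs (suc j) e)

nth-undefined : ∀ {A : Set} (xs ys : List A) j → length xs ≡ length ys →
  nth xs j ≡ nothing → nth ys j ≡ nothing
nth-undefined xs ys zero _ _ = refl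
nth-undefined [] [] (suc j) _ _ = refl
nth-undefined (x ∷ xs) (y ∷ ys) (suc zero) _ ()
nth-undefined (x ∷ xs) (y ∷ ys) (suc (suc j)) len e =
  nth-undefined xs ys (suc j) (cong pred len) e

indexIn-∉ : ∀ {x} θ → x ∉ θ → indexIn x θ ≡ nothing
indexIn-∉ [] x∉θ = refl
indexIn-∉ {x} (y ∷ θ) x∉θ with x ≡ᵇ y in x≡ᵇy
... | true = ⊥-elim (x∉θ (here (≡ᵇ⇒≡ x y (Equivalence.from T-≡ x≡ᵇy))))
... | false = cong (maybe-map suc) (indexIn-∉ θ (x∉θ ∘ there))

indexIn-nth : ∀ θ j {x} → Unique θ → nth θ j ≡ just x → indexIn x θ ≡ just j
indexIn-nth (y ∷ θ) (suc zero) _ refl with y ≡ᵇ y in y≡ᵇy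
... | true = refl
... | false with () ← subst T y≡ᵇy (≡⇒≡ᵇ y y refl)
indexIn-nth (y ∷ θ) (suc (suc j)) {x} (y∉θ ∷ uθ) e with x ≡ᵇ y in x≡ᵇy
... | true = ⊥-elim (All-lookup y∉θ (nth-∈ θ (suc j) e) (sym (≡ᵇ⇒≡ x y (Equivalence.from T-≡ x≡ᵇy))))
... | false = cong (maybe-map suc) (indexIn-nth θ (suc j) uθ e)

symRel-outer : ∀ {x y} θ θ' Γ Δ → x ∉ θ → y ∉ θ' →
  SymRel Γ Δ x y → SymRel (θ ∷ Γ) (θ' ∷ Δ) x y
symRel-outer {x} {y} θ θ' Γ Δ x∉θ y∉θ' rel
  rewrite indexIn-∉ θ x∉θ | indexIn-∉ θ' y∉θ' with rel
... | inj₁ ((i , j) , px , py) rewrite px | py = inj₁ ((suc i , j) , refl , refl)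
... | inj₂ (px , py , x≡y) rewrite px | py = inj₂ (refl , refl , x≡y)

symRel-inner : ∀ {x y} θ θ' Γ Δ j → indexIn x θ ≡ just j → indexIn y θ' ≡ just j →
  SymRel (θ ∷ Γ) (θ' ∷ Δ) x y
symRel-inner θ θ' Γ Δ j ix iy rewrite ix | iy = inj₁ ((1 , j) , refl , refl)

record Agree (τ : ℕ → ℕ) (Γ Δ V W : List (List Sym)) : Set where
  constructor agree
  field related : ∀ i j → SymRel Γ Δ (get V (liftIx τ i) j) (get W i j)
open Agree

agree-cong : ∀ {τ τ' Γ Δ V W} → (∀ a → τ a ≡ τ' a) →
  Agree τ Γ Δ V W → Agree τ' Γ Δ V W
agree-cong {Γ = Γ} {Δ} {V} {W} τ≗τ' ag = agree λ i j →
  subst (λ a → SymRel Γ Δ (get V a j) (get W i j)) (liftIx-cong i) (related ag i j)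
  where
  liftIx-cong : ∀ i → liftIx _ i ≡ liftIx _ i
  liftIx-cong zero = refl
  liftIx-cong (suc a) = cong suc (τ≗τ' a)

agree-id : ∀ {Γ Δ V W} → Agree id Γ Δ V W → ∀ i j → SymRel Γ Δ (get V i j) (get W i j)
agree-id {Γ} {Δ} {V} {W} ag i j =
  subst (λ a → SymRel Γ Δ (get V a j) (get W i j)) (liftIx-id i) (related ag i j)

agree-top : ∀ {τ} V W → (∀ i → nth V (liftIx τ i) ≡ nth W i) → Agree τ [] [] V W
agree-top V W same = agree λ i j → inj₂ (refl , refl , get-cong V W (liftIx _ i) i j (same i))

Avoids : List Sym → List (List Sym) → Set
Avoids θ V = ∀ i j → get V i j ∉ θ

agree-ext : ∀ {τ Γ Δ V W} θ θ' → Unique θ → Unique θ' → length θ ≡ length θ' →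
  Avoids θ V → Avoids θ' W → Agree τ Γ Δ V W →
  Agree (liftIx τ) (θ ∷ Γ) (θ' ∷ Δ) (θ ∷ V) (θ' ∷ W)
agree-ext {τ} {Γ} {Δ} {V} {W} θ θ' uθ uθ' len avV avW (agree rel) = agree extended
  where
  outer : ∀ i j → SymRel (θ ∷ Γ) (θ' ∷ Δ) (get V (liftIx τ i) j) (get W i j)
  outer i j = symRel-outer θ θ' Γ Δ (avV (liftIx τ i) j) (avW i j) (rel i j)

  extended : ∀ i j →
    SymRel (θ ∷ Γ) (θ' ∷ Δ) (get (θ ∷ V) (liftIx (liftIx τ) i) j) (get (θ' ∷ W) i j)
  extended zero j = outer 0 j
  extended (suc (suc i)) j = outer (suc i) j
  extended (suc zero) j with nth θ j in eθ | nth θ' j in eθ'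
  ... | just x | just y =
    symRel-inner θ θ' Γ Δ j (indexIn-nth θ j uθ eθ) (indexIn-nth θ' j uθ' eθ')
  ... | nothing | nothing = outer 0 0
  ... | nothing | just y with () ← trans (sym eθ') (nth-undefined θ θ' j len eθ)
  ... | just x | nothing with () ← trans (sym eθ) (nth-undefined θ' θ j (sym len) eθ')

fresh-unique : ∀ n V M → Unique (fresh n V M)
fresh-unique n V M = applyUpTo⁺₁ _ n
  (λ a<b _ eq → <⇒≢ a<b (+-cancelˡ-≡ (maxSym V ⊔ maxSym M) _ _ (suc-injective eq)))

fresh-length : ∀ n V M W N → length (fresh n V M) ≡ length (fresh n W N)
fresh-length n V M W N = trans (length-applyUpTo _ n) (sym (length-applyUpTo _ n))

fresh-above : ∀ n V M {x} → x ≤ maxSym V ⊔ maxSym M → x ∉ fresh n V M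
fresh-above n V M x≤B x∈θ with ∈-applyUpTo⁻ _ x∈θ
... | a , _ , refl = <⇒≱ (s≤s (m≤m+n _ a)) x≤B

fresh-avoidsᵛ : ∀ n V M → Avoids (fresh n V M) V
fresh-avoidsᵛ n V M i j = fresh-above n V M (≤-trans (get-≤-maxSym V i j) (m≤m⊔n _ _))

fresh-avoidsᵐ : ∀ n V M → Avoids (fresh n V M) M
fresh-avoidsᵐ n V M i j = fresh-above n V M (≤-trans (get-≤-maxSym M i j) (m≤n⊔m _ _))

agree-freshᵛ : ∀ n V W M N {τ Γ Δ} → Agree τ Γ Δ V W →
  Agree (liftIx τ) (fresh n V M ∷ Γ) (fresh n W N ∷ Δ) (fresh n V M ∷ V) (fresh n W N ∷ W)
agree-freshᵛ n V W M N = agree-ext (fresh n V M) (fresh n W N)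
  (fresh-unique n V M) (fresh-unique n W N) (fresh-length n V M W N)
  (fresh-avoidsᵛ n V M) (fresh-avoidsᵛ n W N)

agree-freshᵐ : ∀ n V W M N {τ Γ Δ} → Agree τ Γ Δ M N →
  Agree (liftIx τ) (fresh n V M ∷ Γ) (fresh n W N ∷ Δ) (fresh n V M ∷ M) (fresh n W N ∷ N)
agree-freshᵐ n V W M N = agree-ext (fresh n V M) (fresh n W N)
  (fresh-unique n V M) (fresh-unique n W N) (fresh-length n V M W N)
  (fresh-avoidsᵐ n V M) (fresh-avoidsᵐ n W N)

U-shiftV : ∀ t k c {V W M N Γv Δv Γm Δm} →
  Agree (shiftIx k c) Γv Δv V W → Agree id Γm Δm M N →
  AlphaEq Γv Δv Γm Δm (U V M (iter (shiftV k) c t)) (U W N t)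
U-shiftV (v i j) k c agV agM rewrite iter-shiftV-v k c i j = avar (related agV i j)
U-shiftV (m i j) k c agV agM rewrite iter-fixed (shiftV k) {m i j} refl c =
  amat (agree-id agM i j)
U-shiftV (app t u) k c agV agM
  rewrite iter-natural₂ (shiftV k) (shiftV k) (shiftV k) app (λ _ _ → refl) c t u =
  aapp (U-shiftV t k c agV agM) (U-shiftV u k c agV agM)
U-shiftV (lam n p s) k c {V} {W} {M} {N} agV agM
  rewrite iter-natural₂ (shiftV k) (shiftV k) (shiftV (suc k)) (lam n) (λ _ _ → refl) c p s =
  alam (fresh-length n V M W N)
    (U-shiftV p k c agV (agree-cong liftIx-id (agree-freshᵐ n V W M N agM)))
    (U-shiftV s (suc k) c (agree-cong (sym ∘ shiftIx-suc k c) (agree-freshᵛ n V W M N agV)) agM)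

U-shiftM : ∀ t k c {V W M N Γv Δv Γm Δm} →
  Agree id Γv Δv V W → Agree (shiftIx k c) Γm Δm M N →
  AlphaEq Γv Δv Γm Δm (U V M (iter (shiftM k) c t)) (U W N t)
U-shiftM (v i j) k c agV agM rewrite iter-fixed (shiftM k) {v i j} refl c =
  avar (agree-id agV i j)
U-shiftM (m i j) k c agV agM rewrite iter-shiftM-m k c i j = amat (related agM i j)
U-shiftM (app t u) k c agV agM
  rewrite iter-natural₂ (shiftM k) (shiftM k) (shiftM k) app (λ _ _ → refl) c t u =
  aapp (U-shiftM t k c agV agM) (U-shiftM u k c agV agM)
U-shiftM (lam n p s) k c {V} {W} {M} {N} agV agM
  rewrite iter-natural₂ (shiftM k) (shiftM (suc k)) (shiftM k) (lam n) (λ _ _ → refl) c p s =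
  alam (fresh-length n V M W N)
    (U-shiftM p (suc k) c agV (agree-cong (sym ∘ shiftIx-suc k c) (agree-freshᵐ n V W M N agM)))
    (U-shiftM s k c (agree-cong liftIx-id (agree-freshᵛ n V W M N agV)) agM)

-- Both parts are the renaming lemmas at c = i - 1, started from the
-- top-level relation between X and the cut stack X↓ given by nth-cut.
lemma4p7 : (t : Term) (k i n : ℕ) → 1 ≤ i → k + i ≤ n →
    (X : List (List Sym)) → length X ≡ n → All Unique X →
    (V M : List (List Sym)) → All Unique V → All Unique M →
    (∀ q → q ∈ fv t ++ fm t → InRange X n i q) →
    (U X M (iter (shiftV k) (i ∸ 1) t)
    =α U (take k X ++ drop (k + i ∸ 1) X) M t)
    × (U V X (iter (shiftM k) (i ∸ 1) t)
    =α U V (take k X ++ drop (k + i ∸ 1) X) t)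
lemma4p7 t k i n 1≤i k+i≤n X |X|≡n _ V M _ _ _ rewrite +-∸-assoc k 1≤i =
  U-shiftV t k c (agree-top X X↓ (nth-cut X k c k≤|X|)) (agree-top M M (nth-id M)) ,
  U-shiftM t k c (agree-top V V (nth-id V)) (agree-top X X↓ (nth-cut X k c k≤|X|))
  where
  c : ℕ
  c = i ∸ 1
  X↓ : List (List Sym)
  X↓ = take k X ++ drop (k + c) X
  k≤|X| : k ≤ length X
  k≤|X| = subst (k ≤_) (sym |X|≡n) (m+n≤o⇒m≤o k k+i≤n)
  nth-id : ∀ Y a → nth Y (liftIx id a) ≡ nth Y a
  nth-id Y a = cong (nth Y) (liftIx-id a)
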